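{- Let $\mathbf{C}$ be one of the sequent calculi $\forall^+_1\mathrm{FL_e}$, $\forall^+_1\mathrm{FL_{ew}}$, $\forall^+_1\mathrm{FL_{ec}}$. Suppose $d$ is a derivation in $\mathbf{C}$ of a sequent $\Gamma(\bar y),\Pi(\bar z)\Rightarrow\Delta(\bar z)$, where $\bar y\cap\bar z=\emptyset$ (the free variables of formulas in $\Gamma$ lie in $\bar y$ and those of formulas in $\Pi,\Delta$ lie in $\bar z$). Then there exist a sentence $\chi$ and derivations $d_1,d_2$ in $\mathbf{C}$ with $\mathrm{md}(d_1),\mathrm{md}(d_2)\le\mathrm{md}(d)$ such that $d_1$ derives $\Gamma(\bar y)\Rightarrow\chi$ and $d_2$ derives $\Pi(\bar z),\chi\Rightarrow\Delta(\bar z)$.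
   Context: Formulas: first-order formulas built from unary predicates $P_i$ ($i\in\mathbb{N}$), variables $x,x_0,x_1,\dots$, binary connectives $\lor,\land,\cdot,\to$, constants $\mathrm{f},\mathrm{e}$, and quantifiers $\forall x,\exists x$ (only the variable $x$ is quantified), such that no variable $x_i$ occurs in the scope of a quantifier. A sentence is a formula with no free variables. A sequent $\Gamma\Rightarrow\Delta$ is a pair of finite multisets of formulas with $\Delta$ containing at most one formula. The calculus $\forall^+_1\mathrm{FL_e}$ has axioms $\varphi\Rightarrow\varphi$, $\mathrm{f}\Rightarrow$, $\Rightarrow\mathrm{e}$ and rules (premises / conclusion): from $\Gamma\Rightarrow\Delta$ infer $\Gamma,\mathrm{e}\Rightarrow\Delta$; from $\Gamma\Rightarrow$ infer $\Gamma\Rightarrow\mathrm{f}$; from $\Gamma_1\Rightarrow\varphi$ and $\Gamma_2,\psi\Rightarrow\Delta$ infer $\Gamma_1,\Gamma_2,\varphi\to\psi\Rightarrow\Delta$; from $\Gamma,\varphi\Rightarrow\psi$ infer $\Gamma\Rightarrow\varphi\to\psi$; from $\Gamma,\varphi,\psi\Rightarrow\Delta$ infer $\Gamma,\varphi\cdot\psi\Rightarrow\Delta$; from $\Gamma_1\Rightarrow\varphi$ and $\Gamma_2\Rightarrow\psi$ infer $\Gamma_1,\Gamma_2\Rightarrow\varphi\cdot\psi$; from $\Gamma,\varphi\Rightarrow\Delta$ (resp. $\Gamma,\psi\Rightarrow\Delta$) infer $\Gamma,\varphi\land\psi\Rightarrow\Delta$; from $\Gamma\Rightarrow\varphi$ and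 $\Gamma\Rightarrow\psi$ infer $\Gamma\Rightarrow\varphi\land\psi$; from $\Gamma,\varphi\Rightarrow\Delta$ and $\Gamma,\psi\Rightarrow\Delta$ infer $\Gamma,\varphi\lor\psi\Rightarrow\Delta$; from $\Gamma\Rightarrow\varphi$ (resp. $\Gamma\Rightarrow\psi$) infer $\Gamma\Rightarrow\varphi\lor\psi$; ($\forall\Rightarrow$) from $\Gamma,\varphi(t)\Rightarrow\Delta$ infer $\Gamma,\forall x\varphi(x)\Rightarrow\Delta$; ($\Rightarrow\forall$) from $\Gamma\Rightarrow\psi(y)$ infer $\Gamma\Rightarrow\forall x\psi(x)$; ($\exists\Rightarrow$) from $\Gamma,\varphi(y)\Rightarrow\Delta$ infer $\Gamma,\exists x\varphi(x)\Rightarrow\Delta$; ($\Rightarrow\exists$) from $\Gamma\Rightarrow\psi(t)$ infer $\Gamma\Rightarrow\exists x\psi(x)$; subject to: in ($\forall\Rightarrow$), ($\Rightarrow\exists$) the term $t$ is a variable occurring in the conclusion, and in ($\Rightarrow\forall$), ($\exists\Rightarrow$) the variable $y$ does not occur freely in the conclusion. There is no cut rule. $\forall^+_1\mathrm{FL_{ew}}$ adds weakening: from $\Gamma_1\Rightarrow\Delta_1$ infer $\Gamma_1,\Gamma_2\Rightarrow\Delta_1,\Delta_2$ (with at most one formula on the right); $\forall^+_1\mathrm{FL_{ec}}$ adds contraction: from $\Gamma_1,\Gamma_2,\Gamma_2\Rightarrow\Delta$ infer $\Gamma_1,\Gamma_2\Rightarrow\Delta$. For a derivation $d$, $\mathrm{md}(d)$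 is the maximum number of applications of the four quantifier rules ($\forall\Rightarrow$), ($\Rightarrow\forall$), ($\exists\Rightarrow$), ($\Rightarrow\exists$) on a branch of $d$. -}

module Defs where

open import Data.Nat using (ℕ; _≤_; _⊔_; suc)
open import Data.Bool using (Bool; true; false)
open import Data.List using (List; []; _∷_; _++_; [_])
open import Data.List.Relation.Unary.Any using (Any)
open import Data.List.Relation.Binary.Permutation.Propositional using (_↭_)
open import Data.Maybe using (Maybe; just; nothing)
open import Data.Sum using (_⊎_)
open import Data.Empty using (⊥)
open import Data.Unit using (⊤)
open import Relation.Binary.PropositionalEquality using (_≡_)
open import Relation.Nullary using (¬_)

-- Variables (terms): the quantifiable variable x and the variables x_i.

data Term : Set where
  vx : Term
  vv : ℕ → Term

-- Formulas.  Fm true  = formulas in the scope of a quantifier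
--                       (no x_i may occur there; only x),
--            Fm false = formulas (x_i allowed outside quantifier scopes).

data Fm : Bool → Set where
  Px   : ∀ {b} → ℕ → Fm b
  Pv   : ℕ → ℕ → Fm false
  _∨ᶠ_ : ∀ {b} → Fm b → Fm b → Fm b
  _∧ᶠ_ : ∀ {b} → Fm b → Fm b → Fm b
  _·ᶠ_ : ∀ {b} → Fm b → Fm b → Fm b
  _→ᶠ_ : ∀ {b} → Fm b → Fm b → Fm b
  fᶠ   : ∀ {b} → Fm b
  eᶠ   : ∀ {b} → Fm b
  ∀ᶠ   : ∀ {b} → Fm true → Fm b
  ∃ᶠ   : ∀ {b} → Fm true → Fm b

Formula : Set
Formula = Fm false

atom : ℕ → Term → Formula
atom i vx     = Px i
atom i (vv j) = Pv i j

sub : Term → Fm true → Formula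
sub t (Px i)   = atom i t
sub t (φ ∨ᶠ ψ) = sub t φ ∨ᶠ sub t ψ
sub t (φ ∧ᶠ ψ) = sub t φ ∧ᶠ sub t ψ
sub t (φ ·ᶠ ψ) = sub t φ ·ᶠ sub t ψ
sub t (φ →ᶠ ψ) = sub t φ →ᶠ sub t ψ
sub t fᶠ       = fᶠ
sub t eᶠ       = eᶠ
sub t (∀ᶠ φ)   = ∀ᶠ φ
sub t (∃ᶠ φ)   = ∃ᶠ φ

FreeIn : Term → Formula → Set
FreeIn t (Px i)   = t ≡ vx
FreeIn t (Pv i j) = t ≡ vv j
FreeIn t (φ ∨ᶠ ψ) = FreeIn t φ ⊎ FreeIn t ψ
FreeIn t (φ ∧ᶠ ψ) = FreeIn t φ ⊎ FreeIn t ψ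
FreeIn t (φ ·ᶠ ψ) = FreeIn t φ ⊎ FreeIn t ψ
FreeIn t (φ →ᶠ ψ) = FreeIn t φ ⊎ FreeIn t ψ
FreeIn t fᶠ       = ⊥
FreeIn t eᶠ       = ⊥
FreeIn t (∀ᶠ φ)   = ⊥
FreeIn t (∃ᶠ φ)   = ⊥

OccursIn : Term → Formula → Set
OccursIn t (Px i)   = t ≡ vx
OccursIn t (Pv i j) = t ≡ vv j
OccursIn t (φ ∨ᶠ ψ) = OccursIn t φ ⊎ OccursIn t ψ
OccursIn t (φ ∧ᶠ ψ) = OccursIn t φ ⊎ OccursIn t ψ
OccursIn t (φ ·ᶠ ψ) = OccursIn t φ ⊎ OccursIn t ψ
OccursIn t (φ →ᶠ ψ) = OccursIn t φ ⊎ OccursIn t ψ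
OccursIn t fᶠ       = ⊥
OccursIn t eᶠ       = ⊥
OccursIn t (∀ᶠ φ)   = t ≡ vx
OccursIn t (∃ᶠ φ)   = t ≡ vx

Sentence : Formula → Set
Sentence φ = ∀ t → ¬ FreeIn t φ

OnRight : (Formula → Set) → Maybe Formula → Set
OnRight P nothing  = ⊥
OnRight P (just φ) = P φ

FreeInSeq : Term → List Formula → Maybe Formula → Set
FreeInSeq t Γ Δ = Any (FreeIn t) Γ ⊎ OnRight (FreeIn t) Δ

OccursInSeq : Term → List Formula → Maybe Formula → Set
OccursInSeq t Γ Δ = Any (OccursIn t) Γ ⊎ OnRight (OccursIn t) Δ

data Calc : Set where
  FLe FLew FLec : Calc

-- Derivations of Γ ⇒ Δ.  Multisets are represented by lists; the rule
-- `exch` (permutation of the antecedent) makes the list order irrelevant.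
data Der (C : Calc) : List Formula → Maybe Formula → Set where
  ax   : ∀ {φ} → Der C [ φ ] (just φ)
  fL   : Der C [ fᶠ ] nothing
  eR   : Der C [] (just eᶠ)
  exch : ∀ {Γ Γ' Δ} → Γ ↭ Γ' → Der C Γ Δ → Der C Γ' Δ
  eL   : ∀ {Γ Δ} → Der C Γ Δ → Der C (Γ ++ [ eᶠ ]) Δ
  fR   : ∀ {Γ} → Der C Γ nothing → Der C Γ (just fᶠ)
  →L   : ∀ {Γ₁ Γ₂ φ ψ Δ} → Der C Γ₁ (just φ) → Der C (Γ₂ ++ [ ψ ]) Δ →
         Der C (Γ₁ ++ Γ₂ ++ [ φ →ᶠ ψ ]) Δ
  →R   : ∀ {Γ φ ψ} → Der C (Γ ++ [ φ ]) (just ψ) → Der C Γ (just (φ →ᶠ ψ))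
  ·L   : ∀ {Γ φ ψ Δ} → Der C (Γ ++ φ ∷ ψ ∷ []) Δ → Der C (Γ ++ [ φ ·ᶠ ψ ]) Δ
  ·R   : ∀ {Γ₁ Γ₂ φ ψ} → Der C Γ₁ (just φ) → Der C Γ₂ (just ψ) →
         Der C (Γ₁ ++ Γ₂) (just (φ ·ᶠ ψ))
  ∧L₁  : ∀ {Γ φ ψ Δ} → Der C (Γ ++ [ φ ]) Δ → Der C (Γ ++ [ φ ∧ᶠ ψ ]) Δ
  ∧L₂  : ∀ {Γ φ ψ Δ} → Der C (Γ ++ [ ψ ]) Δ → Der C (Γ ++ [ φ ∧ᶠ ψ ]) Δ
  ∧R   : ∀ {Γ φ ψ} → Der C Γ (just φ) → Der C Γ (just ψ) → Der C Γ (just (φ ∧ᶠ ψ))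
  ∨L   : ∀ {Γ φ ψ Δ} → Der C (Γ ++ [ φ ]) Δ → Der C (Γ ++ [ ψ ]) Δ →
         Der C (Γ ++ [ φ ∨ᶠ ψ ]) Δ
  ∨R₁  : ∀ {Γ φ ψ} → Der C Γ (just φ) → Der C Γ (just (φ ∨ᶠ ψ))
  ∨R₂  : ∀ {Γ φ ψ} → Der C Γ (just ψ) → Der C Γ (just (φ ∨ᶠ ψ))
  ∀L   : ∀ {Γ φ Δ} (t : Term) → OccursInSeq t (Γ ++ [ ∀ᶠ φ ]) Δ →
         Der C (Γ ++ [ sub t φ ]) Δ → Der C (Γ ++ [ ∀ᶠ φ ]) Δ
  ∀R   : ∀ {Γ ψ} (y : Term) → ¬ FreeInSeq y Γ (just (∀ᶠ ψ)) →
         Der C Γ (just (sub y ψ)) → Der C Γ (just (∀ᶠ ψ))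
  ∃L   : ∀ {Γ φ Δ} (y : Term) → ¬ FreeInSeq y (Γ ++ [ ∃ᶠ φ ]) Δ →
         Der C (Γ ++ [ sub y φ ]) Δ → Der C (Γ ++ [ ∃ᶠ φ ]) Δ
  ∃R   : ∀ {Γ ψ} (t : Term) → OccursInSeq t Γ (just (∃ᶠ ψ)) →
         Der C Γ (just (sub t ψ)) → Der C Γ (just (∃ᶠ ψ))
  wkL  : ∀ {Γ₁ Γ₂ Δ} → C ≡ FLew → Der C Γ₁ Δ → Der C (Γ₁ ++ Γ₂) Δ
  wkR  : ∀ {Γ₁ Γ₂ φ} → C ≡ FLew → Der C Γ₁ nothing → Der C (Γ₁ ++ Γ₂) (just φ)
  ctr  : ∀ {Γ₁ Γ₂ Δ} → C ≡ FLec → Der C (Γ₁ ++ Γ₂ ++ Γ₂) Δ → Der C (Γ₁ ++ Γ₂) Δ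

md : ∀ {C Γ Δ} → Der C Γ Δ → ℕ
md ax            = 0
md fL            = 0
md eR            = 0
md (exch _ d)    = md d
md (eL d)        = md d
md (fR d)        = md d
md (→L d e)      = md d ⊔ md e
md (→R d)        = md d
md (·L d)        = md d
md (·R d e)      = md d ⊔ md e
md (∧L₁ d)       = md d
md (∧L₂ d)       = md d
md (∧R d e)      = md d ⊔ md e
md (∨L d e)      = md d ⊔ md e
md (∨R₁ d)       = md d
md (∨R₂ d)       = md d
md (∀L _ _ d)    = suc (md d)
md (∀R _ _ d)    = suc (md d)
md (∃L _ _ d)    = suc (md d)
md (∃R _ _ d)    = suc (md d)
md (wkL _ d)     = md d
md (wkR _ d)     = md d
md (ctr _ d)     = md d

FVsIn : List Formula → List Term → Set
FVsIn Γ ys = ∀ t → Any (FreeIn t) Γ → Any (t ≡_) ys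

FVsInR : Maybe Formula → List Term → Set
FVsInR Δ ys = ∀ t → OnRight (FreeIn t) Δ → Any (t ≡_) ys

DisjointVars : List Term → List Term → Set
DisjointVars ys zs = ∀ t → Any (t ≡_) ys → Any (t ≡_) zs → ⊥

-- Maehara's method.  By induction on d, for every partition A | B of the antecedent in which no
-- variable is free both in A and in B ⇒ Δ, one builds a sentence χ with A ⇒ χ and B, χ ⇒ Δ,
-- assembling the interpolant of each rule from those of its premises so that no branch of the
-- new derivations passes through more quantifier inferences than a branch of d.  Since only x
-- is ever bound and no x_i occurs under a quantifier, every quantified formula is a sentence.
-- Hence when the instance variable of (∀⇒) or (⇒∃) is free on the other side of the partition,
-- the quantified formula itself is carried into the interpolant (∀xφ · χ, ∀xφ → χ or χ → ∃xψ);
-- and the eigenvariable conditions of (⇒∀), (∃⇒) survive because χ has no free variables.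

module Submission where

open import Defs
open import Data.Nat using (ℕ; _≤_; _⊔_; suc; z≤n; s≤s)
open import Data.Nat.Properties using (≤-trans; ≤-reflexive; m≤n⇒m≤1+n; ⊔-mono-≤; ⊔-lub)
import Data.Nat as ℕ
open import Data.List using (List; []; _∷_; _++_; [_])
open import Data.List.Properties using (++-assoc; ++-identityʳ; ++-conicalˡ; ++-conicalʳ)
open import Data.List.Relation.Unary.Any using (Any; here; there; any?)
import Data.List.Relation.Unary.Any as Any
import Data.List.Relation.Unary.Any.Properties as AnyP
open import Data.List.Membership.Propositional.Properties using (∈-++⁻; ∈-∃++)
open import Data.List.Relation.Binary.Permutation.Propositional
  using (_↭_; ↭-refl; ↭-sym; ↭-trans; ↭-reflexive; prep)
open import Data.List.Relation.Binary.Permutation.Propositional.Properties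
  using (++⁺ˡ; ++⁺ʳ; ++⁺; ++-comm; Any-resp-↭; ∈-resp-↭; drop-mid; shift; shifts;
         ↭-singleton-inv; ↭-empty-inv; ++-commutativeMonoid)
open import Data.Maybe using (Maybe; just; nothing)
open import Data.Product using (Σ; _×_; _,_)
open import Data.Sum using (_⊎_; inj₁; inj₂) renaming ([_,_] to either)
import Data.Sum as Sum
open import Data.Empty using (⊥; ⊥-elim)
open import Relation.Binary.PropositionalEquality using (_≡_; refl; sym)
open import Relation.Nullary using (¬_; Dec; yes; no)
open import Relation.Nullary.Decidable using (_⊎-dec_)
open import Algebra.Solver.CommutativeMonoid (++-commutativeMonoid {A = Formula})
  using (solve; _⊜_; _⊕_)

module _ {a} {X : Set a} where

  record Refinement (Γ₁ Γ₂ A B : List X) : Set a where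
    field
      A₁ A₂ B₁ B₂ : List X
      Γ₁↭ : Γ₁ ↭ A₁ ++ B₁
      Γ₂↭ : Γ₂ ↭ A₂ ++ B₂
      A↭  : A ↭ A₁ ++ A₂
      B↭  : B ↭ B₁ ++ B₂

  refine : ∀ Γ₁ {Γ₂ A B} → Γ₁ ++ Γ₂ ↭ A ++ B → Refinement Γ₁ Γ₂ A B
  refine [] {Γ₂} {A} {B} p = record
    { A₁ = [] ; A₂ = A ; B₁ = [] ; B₂ = B
    ; Γ₁↭ = ↭-refl ; Γ₂↭ = p ; A↭ = ↭-refl ; B↭ = ↭-refl }
  refine (x ∷ Γ₁) {Γ₂} {A} {B} p with ∈-++⁻ A (∈-resp-↭ p (here refl))
  ... | inj₁ x∈A with ∈-∃++ x∈A
  ...   | A₀ , A₀' , refl = record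
    { A₁ = x ∷ R.A₁ ; A₂ = R.A₂ ; B₁ = R.B₁ ; B₂ = R.B₂
    ; Γ₁↭ = prep x R.Γ₁↭ ; Γ₂↭ = R.Γ₂↭
    ; A↭ = ↭-trans (shift x A₀ A₀') (prep x R.A↭) ; B↭ = R.B↭ }
    where
    p' : Γ₁ ++ Γ₂ ↭ (A₀ ++ A₀') ++ B
    p' = ↭-trans (drop-mid [] A₀ (↭-trans p (↭-reflexive (++-assoc A₀ (x ∷ A₀') B))))
                 (↭-reflexive (sym (++-assoc A₀ A₀' B)))
    module R = Refinement (refine Γ₁ {A = A₀ ++ A₀'} p')
  refine (x ∷ Γ₁) {Γ₂} {A} {B} p | inj₂ x∈B with ∈-∃++ x∈B
  ...   | B₀ , B₀' , refl = record
    { A₁ = R.A₁ ; A₂ = R.A₂ ; B₁ = x ∷ R.B₁ ; B₂ = R.B₂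
    ; Γ₁↭ = ↭-trans (prep x R.Γ₁↭) (↭-sym (shift x R.A₁ R.B₁)) ; Γ₂↭ = R.Γ₂↭
    ; A↭ = R.A↭ ; B↭ = ↭-trans (shift x B₀ B₀') (prep x R.B↭) }
    where
    p' : Γ₁ ++ Γ₂ ↭ A ++ (B₀ ++ B₀')
    p' = ↭-trans (drop-mid [] (A ++ B₀) (↭-trans p (↭-reflexive (sym (++-assoc A B₀ (x ∷ B₀'))))))
                 (↭-reflexive (++-assoc A B₀ B₀'))
    module R = Refinement (refine Γ₁ {A = A} p')

  ++-≡-[_] : ∀ x {A B : List X} → A ++ B ≡ [ x ] → (A ≡ [ x ] × B ≡ []) ⊎ (A ≡ [] × B ≡ [ x ])
  ++-≡-[ x ] {[]}         refl = inj₂ (refl , refl)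
  ++-≡-[ x ] {_ ∷ []} {[]} refl = inj₁ (refl , refl)

  data Side (Γ : List X) (x : X) (A B : List X) : Set a where
    inA : ∀ A' → A ↭ A' ++ [ x ] → Γ ↭ A' ++ B → Side Γ x A B
    inB : ∀ B' → B ↭ B' ++ [ x ] → Γ ↭ A ++ B' → Side Γ x A B

  side : ∀ Γ {x A B} → Γ ++ [ x ] ↭ A ++ B → Side Γ x A B
  side Γ {x} {A} p with refine Γ {A = A} p
  ... | record { A₁ = A₁ ; A₂ = A₂ ; B₁ = B₁ ; B₂ = B₂ ; Γ₁↭ = Γ↭ ; Γ₂↭ = x↭ ; A↭ = A↭ ; B↭ = B↭ }
    with ++-≡-[ x ] {A₂} (↭-singleton-inv (↭-sym x↭))
  ... | inj₁ (refl , refl) =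
    inA A₁ A↭ (↭-trans Γ↭ (++⁺ˡ A₁ (↭-sym (↭-trans B↭ (↭-reflexive (++-identityʳ B₁))))))
  ... | inj₂ (refl , refl) =
    inB B₁ B↭ (↭-trans Γ↭ (++⁺ʳ B₁ (↭-sym (↭-trans A↭ (↭-reflexive (++-identityʳ A₁))))))

_≟ᵗ_ : (s t : Term) → Dec (s ≡ t)
vx   ≟ᵗ vx   = yes refl
vx   ≟ᵗ vv _ = no λ ()
vv _ ≟ᵗ vx   = no λ ()
vv i ≟ᵗ vv j with i ℕ.≟ j
... | yes refl = yes refl
... | no i≢j   = no λ { refl → i≢j refl }

FreeIn? : ∀ t φ → Dec (FreeIn t φ)
FreeIn? t (Px i)   = t ≟ᵗ vx
FreeIn? t (Pv i j) = t ≟ᵗ vv j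
FreeIn? t (φ ∨ᶠ ψ) = FreeIn? t φ ⊎-dec FreeIn? t ψ
FreeIn? t (φ ∧ᶠ ψ) = FreeIn? t φ ⊎-dec FreeIn? t ψ
FreeIn? t (φ ·ᶠ ψ) = FreeIn? t φ ⊎-dec FreeIn? t ψ
FreeIn? t (φ →ᶠ ψ) = FreeIn? t φ ⊎-dec FreeIn? t ψ
FreeIn? t fᶠ       = no λ ()
FreeIn? t eᶠ       = no λ ()
FreeIn? t (∀ᶠ φ)   = no λ ()
FreeIn? t (∃ᶠ φ)   = no λ ()

FreeInSeq? : ∀ t Γ Δ → Dec (FreeInSeq t Γ Δ)
FreeInSeq? t Γ nothing  = any? (FreeIn? t) Γ ⊎-dec no λ ()
FreeInSeq? t Γ (just φ) = any? (FreeIn? t) Γ ⊎-dec FreeIn? t φ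

free-sub : ∀ {u t} ψ → FreeIn u (sub t ψ) → u ≡ t
free-sub {t = vx}   (Px i) u≡x  = u≡x
free-sub {t = vv j} (Px i) u≡xj = u≡xj
free-sub (φ ∨ᶠ ψ) = either (free-sub φ) (free-sub ψ)
free-sub (φ ∧ᶠ ψ) = either (free-sub φ) (free-sub ψ)
free-sub (φ ·ᶠ ψ) = either (free-sub φ) (free-sub ψ)
free-sub (φ →ᶠ ψ) = either (free-sub φ) (free-sub ψ)

free⇒occurs : ∀ {t} φ → FreeIn t φ → OccursIn t φ
free⇒occurs (Px i)   f = f
free⇒occurs (Pv i j) f = f
free⇒occurs (φ ∨ᶠ ψ) = Sum.map (free⇒occurs φ) (free⇒occurs ψ)
free⇒occurs (φ ∧ᶠ ψ) = Sum.map (free⇒occurs φ) (free⇒occurs ψ)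
free⇒occurs (φ ·ᶠ ψ) = Sum.map (free⇒occurs φ) (free⇒occurs ψ)
free⇒occurs (φ →ᶠ ψ) = Sum.map (free⇒occurs φ) (free⇒occurs ψ)

-- Only x can occur bound, so an occurring x_j occurs free.
occurs⇒free : ∀ {j} φ → OccursIn (vv j) φ → FreeIn (vv j) φ
occurs⇒free (Px i)   o = o
occurs⇒free (Pv i k) o = o
occurs⇒free (φ ∨ᶠ ψ) = Sum.map (occurs⇒free φ) (occurs⇒free ψ)
occurs⇒free (φ ∧ᶠ ψ) = Sum.map (occurs⇒free φ) (occurs⇒free ψ)
occurs⇒free (φ ·ᶠ ψ) = Sum.map (occurs⇒free φ) (occurs⇒free ψ)
occurs⇒free (φ →ᶠ ψ) = Sum.map (occurs⇒free φ) (occurs⇒free ψ)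
occurs⇒free (∀ᶠ φ) ()
occurs⇒free (∃ᶠ φ) ()

any-free⇒occurs : ∀ {t Γ} → Any (FreeIn t) Γ → Any (OccursIn t) Γ
any-free⇒occurs = Any.map (free⇒occurs _)

onRight-free⇒occurs : ∀ {t} Δ → OnRight (FreeIn t) Δ → OnRight (OccursIn t) Δ
onRight-free⇒occurs (just φ) = free⇒occurs φ

freeInSeq⇒occursInSeq : ∀ {t Γ} Δ → FreeInSeq t Γ Δ → OccursInSeq t Γ Δ
freeInSeq⇒occursInSeq Δ = Sum.map any-free⇒occurs (onRight-free⇒occurs Δ)

occursInSeq⇒x⊎free : ∀ {t} Γ Δ → OccursInSeq t Γ Δ → t ≡ vx ⊎ FreeInSeq t Γ Δ
occursInSeq⇒x⊎free {vx}   Γ Δ        _ = inj₁ refl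
occursInSeq⇒x⊎free {vv j} Γ nothing  o = inj₂ (Sum.map (Any.map (occurs⇒free _)) (λ ()) o)
occursInSeq⇒x⊎free {vv j} Γ (just φ) o = inj₂ (Sum.map (Any.map (occurs⇒free _)) (occurs⇒free φ) o)

FV : List Formula → Term → Set
FV Γ t = Any (FreeIn t) Γ

_⊆ᶠᵛ_ : List Formula → List Formula → Set
Γ ⊆ᶠᵛ Γ' = ∀ {t} → FV Γ t → FV Γ' t

↭⇒⊆ᶠᵛ : ∀ {Γ Γ'} → Γ ↭ Γ' → Γ ⊆ᶠᵛ Γ'
↭⇒⊆ᶠᵛ p = Any-resp-↭ p

⊆ᶠᵛ-++ˡ : ∀ {Γ Γ'} → Γ ⊆ᶠᵛ (Γ ++ Γ')
⊆ᶠᵛ-++ˡ = AnyP.++⁺ˡ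

⊆ᶠᵛ-++ʳ : ∀ {Γ Γ'} → Γ' ⊆ᶠᵛ (Γ ++ Γ')
⊆ᶠᵛ-++ʳ {Γ} = AnyP.++⁺ʳ Γ

++⁺-⊆ᶠᵛ : ∀ {Γ₁ Γ₁' Γ₂ Γ₂'} → Γ₁ ⊆ᶠᵛ Γ₁' → Γ₂ ⊆ᶠᵛ Γ₂' → (Γ₁ ++ Γ₂) ⊆ᶠᵛ (Γ₁' ++ Γ₂')
++⁺-⊆ᶠᵛ {Γ₁} {Γ₁'} f g a = either (λ a₁ → AnyP.++⁺ˡ (f a₁)) (λ a₂ → AnyP.++⁺ʳ Γ₁' (g a₂)) (AnyP.++⁻ Γ₁ a)

[]⊆ᶠᵛ : ∀ {φ ψ} → (∀ {t} → FreeIn t φ → FreeIn t ψ) → [ φ ] ⊆ᶠᵛ [ ψ ]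
[]⊆ᶠᵛ f (here p) = here (f p)

_⊆ˢ_ : List Formula × Maybe Formula → List Formula × Maybe Formula → Set
(Γ , Δ) ⊆ˢ (Γ' , Δ') = ∀ {t} → FreeInSeq t Γ Δ → FreeInSeq t Γ' Δ'

record Separated (A B : List Formula) (Δ : Maybe Formula) : Set where
  constructor separated
  field apart : ∀ t → FV A t → ¬ FreeInSeq t B Δ

separated-mono : ∀ {A A' B B' Δ Δ'} → A' ⊆ᶠᵛ A → (B' , Δ') ⊆ˢ (B , Δ) →
                 Separated A B Δ → Separated A' B' Δ'
separated-mono f g (separated apart) = separated λ t a b → apart t (f a) (g b)

separated-monoᴬ : ∀ {A A' B Δ} → A' ⊆ᶠᵛ A → Separated A B Δ → Separated A' B Δ
separated-monoᴬ f = separated-mono f (λ b → b)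

separated-monoᴮ : ∀ {A B B' Δ} → B' ⊆ᶠᵛ B → Separated A B Δ → Separated A B' Δ
separated-monoᴮ f = separated-mono (λ a → a) (Sum.map f (λ r → r))

separated-monoᴰ : ∀ {A B φ ψ} → (∀ {t} → FreeIn t ψ → FreeIn t φ) →
                  Separated A B (just φ) → Separated A B (just ψ)
separated-monoᴰ f = separated-mono (λ a → a) (Sum.map (λ b → b) f)

separated-swap : ∀ {A A' B B' Δ Δ'} → (∀ {u} → FreeInSeq u A' Δ' → FV A u) → B' ⊆ᶠᵛ B →
                 Separated A B Δ → Separated B' A' Δ'
separated-swap f g (separated apart) = separated λ u b a → apart u (f a) (inj₁ (g b))

-- An instance φ(t) has at most t free.
separated-extendˡ : ∀ {A B Δ t φ} → ¬ FreeInSeq t B Δ → Separated A B Δ →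
                    Separated (A ++ [ sub t φ ]) B Δ
separated-extendˡ {A} {B} {Δ} {t} {φ} t∉B (separated apart) = separated apart'
  where
  apart' : ∀ u → FV (A ++ [ sub t φ ]) u → ¬ FreeInSeq u B Δ
  apart' u a b with AnyP.++⁻ A a
  ... | inj₁ a' = apart u a' b
  ... | inj₂ (here f) with free-sub φ f
  ...   | refl = t∉B b

separated-extendʳ : ∀ {A B Δ t φ} → ¬ FV A t → Separated A B Δ →
                    Separated A (B ++ [ sub t φ ]) Δ
separated-extendʳ {A} {B} {Δ} {t} {φ} t∉A (separated apart) = separated apart'
  where
  apart' : ∀ u → FV A u → ¬ FreeInSeq u (B ++ [ sub t φ ]) Δ
  apart' u a (inj₂ f) = apart u a (inj₂ f)
  apart' u a (inj₁ b) with AnyP.++⁻ B b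
  ... | inj₁ b' = apart u a (inj₁ b')
  ... | inj₂ (here f) with free-sub φ f
  ...   | refl = t∉A a

separated-instance : ∀ {A B Δ t ψ} → ¬ FV A t → Separated A B Δ →
                     Separated A B (just (sub t ψ))
separated-instance {A} {B} {t = t} {ψ} t∉A (separated apart) = separated apart'
  where
  apart' : ∀ u → FV A u → ¬ FreeInSeq u B (just (sub t ψ))
  apart' u a (inj₁ b) = apart u a (inj₁ b)
  apart' u a (inj₂ f) with free-sub ψ f
  ... | refl = t∉A a

↭-++⇒⊆ᶠᵛˡ : ∀ {Γ A B} → Γ ↭ A ++ B → A ⊆ᶠᵛ Γ
↭-++⇒⊆ᶠᵛˡ p a = ↭⇒⊆ᶠᵛ (↭-sym p) (⊆ᶠᵛ-++ˡ a)

↭-++⇒⊆ᶠᵛʳ : ∀ {Γ A B} → Γ ↭ A ++ B → B ⊆ᶠᵛ Γ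
↭-++⇒⊆ᶠᵛʳ {A = A} p b = ↭⇒⊆ᶠᵛ (↭-sym p) (⊆ᶠᵛ-++ʳ {A} b)

replace-last-⊆ᶠᵛ : ∀ {Γ Γ' Π φ} → Γ ↭ Γ' ++ [ φ ] → Π ⊆ᶠᵛ [ φ ] → (Γ' ++ Π) ⊆ᶠᵛ Γ
replace-last-⊆ᶠᵛ p Π⊆φ a = ↭⇒⊆ᶠᵛ (↭-sym p) (++⁺-⊆ᶠᵛ (λ a' → a') Π⊆φ a)

∷ʳ-sentence-¬FV : ∀ {Γ χ y} → Sentence χ → ¬ FV Γ y → ¬ FV (Γ ++ [ χ ]) y
∷ʳ-sentence-¬FV {Γ} {χ} {y} s y∉Γ a with AnyP.++⁻ Γ a
... | inj₁ a'       = y∉Γ a'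
... | inj₂ (here f) = s y f

fresh-partition : ∀ {y Θ Δ A B} → ¬ FreeInSeq y Θ Δ → Θ ↭ A ++ B →
                  ¬ FV A y × ¬ FreeInSeq y B Δ
fresh-partition y∉ p = (λ a → y∉ (inj₁ (↭-++⇒⊆ᶠᵛˡ p a))) ,
                       either (λ b → y∉ (inj₁ (↭-++⇒⊆ᶠᵛʳ p b))) (λ f → y∉ (inj₂ f))

occurs-partition : ∀ {t Θ Δ A B} → OccursInSeq t Θ Δ → Θ ↭ A ++ B →
                   t ≡ vx ⊎ FV A t ⊎ FreeInSeq t B Δ
occurs-partition {Θ = Θ} {Δ} {A} occ p with occursInSeq⇒x⊎free Θ Δ occ
... | inj₁ t≡x         = inj₁ t≡x
... | inj₂ (inj₂ f)    = inj₂ (inj₂ (inj₂ f))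
... | inj₂ (inj₁ g) with AnyP.++⁻ A (↭⇒⊆ᶠᵛ p g)
...   | inj₁ a = inj₂ (inj₁ a)
...   | inj₂ b = inj₂ (inj₂ (inj₁ b))

swap-last : ∀ (X Y Z : List Formula) → (X ++ Y) ++ Z ↭ (X ++ Z) ++ Y
swap-last = solve 3 (λ x y z → (x ⊕ y) ⊕ z ⊜ (x ⊕ z) ⊕ y) ↭-refl

++-medial-↭ : ∀ (W X Y Z : List Formula) → (W ++ X) ++ (Y ++ Z) ↭ (W ++ Y) ++ (X ++ Z)
++-medial-↭ = solve 4 (λ w x y z → (w ⊕ x) ⊕ (y ⊕ z) ⊜ (w ⊕ y) ⊕ (x ⊕ z)) ↭-refl

++-assoc-↭ : ∀ (X Y Z : List Formula) → (X ++ Y) ++ Z ↭ X ++ (Y ++ Z)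
++-assoc-↭ X Y Z = ↭-reflexive (++-assoc X Y Z)

sentence-∀ : ∀ {φ} → Sentence (∀ᶠ φ)
sentence-∀ t ()

sentence-∃ : ∀ {φ} → Sentence (∃ᶠ φ)
sentence-∃ t ()

sentence-binary : ∀ {χ₁ χ₂} → Sentence χ₁ → Sentence χ₂ → ∀ t → ¬ (FreeIn t χ₁ ⊎ FreeIn t χ₂)
sentence-binary s₁ s₂ t = either (s₁ t) (s₂ t)

record Interpolant (C : Calc) (A B : List Formula) (Δ : Maybe Formula) (n : ℕ) : Set where
  constructor interpolant
  field
    χ        : Formula
    sentence : Sentence χ
    left     : Der C A (just χ)
    right    : Der C (B ++ [ χ ]) Δ
    left-md  : md left ≤ n
    right-md : md right ≤ n

Interpolation : Calc → List Formula → Maybe Formula → ℕ → Set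
Interpolation C Θ Δ n = ∀ A B → Θ ↭ A ++ B → Separated A B Δ → Interpolant C A B Δ n

interpolation-↭ : ∀ {C Θ Θ' Δ n} → Θ ↭ Θ' → Interpolation C Θ Δ n → Interpolation C Θ' Δ n
interpolation-↭ q IH A B p = IH A B (↭-trans q p)

interpolation-ax : ∀ {C φ} → Interpolation C [ φ ] (just φ) 0
interpolation-ax {φ = φ} A B p sep with ++-≡-[ φ ] {A} (↭-singleton-inv (↭-sym p))
... | inj₁ (refl , refl) = interpolant φ (λ t f → Separated.apart sep t (here f) (inj₂ f)) ax ax z≤n z≤n
... | inj₂ (refl , refl) = interpolant eᶠ (λ t ()) eR (eL ax) z≤n z≤n

interpolation-fL : ∀ {C} → Interpolation C [ fᶠ ] nothing 0
interpolation-fL A B p sep with ++-≡-[ fᶠ ] {A} (↭-singleton-inv (↭-sym p))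
... | inj₁ (refl , refl) = interpolant fᶠ (λ t ()) ax fL z≤n z≤n
... | inj₂ (refl , refl) = interpolant eᶠ (λ t ()) eR (eL fL) z≤n z≤n

interpolation-eR : ∀ {C} → Interpolation C [] (just eᶠ) 0
interpolation-eR A B p sep with ↭-empty-inv (↭-sym p)
... | A++B≡[] with ++-conicalˡ A B A++B≡[] | ++-conicalʳ A B A++B≡[]
...   | refl | refl = interpolant eᶠ (λ t ()) eR (eL eR) z≤n z≤n

interpolation-left : ∀ {C Γ Δ φ n} Π
  (rule : ∀ {Γ' Δ'} → Der C (Γ' ++ Π) Δ' → Der C (Γ' ++ [ φ ]) Δ') →
  (∀ {Γ' Δ'} (e : Der C (Γ' ++ Π) Δ') → md (rule e) ≡ md e) → Π ⊆ᶠᵛ [ φ ] →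
  Interpolation C (Γ ++ Π) Δ n → Interpolation C (Γ ++ [ φ ]) Δ n
interpolation-left {Γ = Γ} {φ = φ} Π rule md-rule Π⊆φ IH A B p sep with side Γ p
... | inA A' A↭ Γ↭ =
  interpolant χ sentence (exch (↭-sym A↭) (rule left)) right
    (≤-trans (≤-reflexive (md-rule left)) left-md) right-md
  where
  open Interpolant (IH (A' ++ Π) B (↭-trans (++⁺ʳ Π Γ↭) (swap-last A' B Π))
                       (separated-monoᴬ (replace-last-⊆ᶠᵛ A↭ Π⊆φ) sep))
... | inB B' B↭ Γ↭ =
  interpolant χ sentence left
    (exch (↭-trans (swap-last B' [ χ ] [ φ ]) (++⁺ʳ [ χ ] (↭-sym B↭)))
          (rule (exch (swap-last B' Π [ χ ]) right)))
    left-md (≤-trans (≤-reflexive (md-rule _)) right-md)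
  where
  open Interpolant (IH A (B' ++ Π) (↭-trans (++⁺ʳ Π Γ↭) (++-assoc-↭ A B' Π))
                       (separated-monoᴮ (replace-last-⊆ᶠᵛ B↭ Π⊆φ) sep))

interpolation-right : ∀ {C Γ Δ Δ' n} (rule : ∀ {Γ'} → Der C Γ' Δ → Der C Γ' Δ') →
  (∀ {Γ'} (e : Der C Γ' Δ) → md (rule e) ≡ md e) →
  (∀ {t} → OnRight (FreeIn t) Δ → OnRight (FreeIn t) Δ') →
  Interpolation C Γ Δ n → Interpolation C Γ Δ' n
interpolation-right rule md-rule Δ⊆Δ' IH A B p sep =
  interpolant χ sentence left (rule right) left-md (≤-trans (≤-reflexive (md-rule right)) right-md)
  where open Interpolant (IH A B p (separated-mono (λ a → a) (Sum.map (λ b → b) Δ⊆Δ') sep))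

interpolation-→R : ∀ {C Γ φ ψ n} → Interpolation C (Γ ++ [ φ ]) (just ψ) n →
                   Interpolation C Γ (just (φ →ᶠ ψ)) n
interpolation-→R {φ = φ} {ψ} IH A B p sep =
  interpolant χ sentence left (→R (exch (swap-last B [ φ ] [ χ ]) right)) left-md right-md
  where
  φ-moved : (B ++ [ φ ] , just ψ) ⊆ˢ (B , just (φ →ᶠ ψ))
  φ-moved (inj₁ b) = either inj₁ (λ { (here f) → inj₂ (inj₁ f) }) (AnyP.++⁻ B b)
  φ-moved (inj₂ f) = inj₂ (inj₂ f)
  open Interpolant (IH A (B ++ [ φ ]) (↭-trans (++⁺ʳ [ φ ] p) (++-assoc-↭ A B [ φ ]))
                       (separated-mono (λ a → a) φ-moved sep))

interpolation-∧R : ∀ {C Γ φ ψ m n} → Interpolation C Γ (just φ) m → Interpolation C Γ (just ψ) n →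
                   Interpolation C Γ (just (φ ∧ᶠ ψ)) (m ⊔ n)
interpolation-∧R IH₁ IH₂ A B p sep =
  interpolant (I₁.χ ∧ᶠ I₂.χ) (sentence-binary I₁.sentence I₂.sentence)
    (∧R I₁.left I₂.left) (∧R (∧L₁ I₁.right) (∧L₂ I₂.right))
    (⊔-mono-≤ I₁.left-md I₂.left-md) (⊔-mono-≤ I₁.right-md I₂.right-md)
  where
  module I₁ = Interpolant (IH₁ A B p (separated-monoᴰ inj₁ sep))
  module I₂ = Interpolant (IH₂ A B p (separated-monoᴰ inj₂ sep))

interpolation-·R : ∀ {C Γ₁ Γ₂ φ ψ m n} → Interpolation C Γ₁ (just φ) m → Interpolation C Γ₂ (just ψ) n →
                   Interpolation C (Γ₁ ++ Γ₂) (just (φ ·ᶠ ψ)) (m ⊔ n)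
interpolation-·R {Γ₁ = Γ₁} IH₁ IH₂ A B p sep =
  interpolant (I₁.χ ·ᶠ I₂.χ) (sentence-binary I₁.sentence I₂.sentence)
    (exch (↭-sym A↭) (·R I₁.left I₂.left))
    (·L (exch (↭-trans (++-medial-↭ B₁ [ I₁.χ ] B₂ [ I₂.χ ]) (++⁺ʳ _ (↭-sym B↭)))
              (·R I₁.right I₂.right)))
    (⊔-mono-≤ I₁.left-md I₂.left-md) (⊔-mono-≤ I₁.right-md I₂.right-md)
  where
  open Refinement (refine Γ₁ {A = A} p)
  module I₁ = Interpolant (IH₁ A₁ B₁ Γ₁↭
    (separated-mono (↭-++⇒⊆ᶠᵛˡ A↭) (Sum.map (↭-++⇒⊆ᶠᵛˡ B↭) inj₁) sep))
  module I₂ = Interpolant (IH₂ A₂ B₂ Γ₂↭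
    (separated-mono (↭-++⇒⊆ᶠᵛʳ {A = A₁} A↭) (Sum.map (↭-++⇒⊆ᶠᵛʳ {A = B₁} B↭) inj₂) sep))

interpolation-wkL : ∀ {C Γ₁ Γ₂ Δ n} → C ≡ FLew → Interpolation C Γ₁ Δ n →
                    Interpolation C (Γ₁ ++ Γ₂) Δ n
interpolation-wkL {Γ₁ = Γ₁} w IH A B p sep =
  interpolant χ sentence (exch (↭-sym A↭) (wkL w left))
    (exch (↭-trans (swap-last B₁ [ χ ] B₂) (++⁺ʳ _ (↭-sym B↭))) (wkL w right))
    left-md right-md
  where
  open Refinement (refine Γ₁ {A = A} p)
  open Interpolant (IH A₁ B₁ Γ₁↭
    (separated-monoᴬ (↭-++⇒⊆ᶠᵛˡ A↭) (separated-monoᴮ (↭-++⇒⊆ᶠᵛˡ B↭) sep)))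

interpolation-wkR : ∀ {C Γ₁ Γ₂ φ n} → C ≡ FLew → Interpolation C Γ₁ nothing n →
                    Interpolation C (Γ₁ ++ Γ₂) (just φ) n
interpolation-wkR {Γ₁ = Γ₁} w IH A B p sep =
  interpolant χ sentence (exch (↭-sym A↭) (wkL w left))
    (exch (↭-trans (swap-last B₁ [ χ ] B₂) (++⁺ʳ _ (↭-sym B↭))) (wkR w right))
    left-md right-md
  where
  open Refinement (refine Γ₁ {A = A} p)
  open Interpolant (IH A₁ B₁ Γ₁↭
    (separated-mono (↭-++⇒⊆ᶠᵛˡ A↭) (Sum.map (↭-++⇒⊆ᶠᵛˡ B↭) λ ()) sep))

interpolation-ctr : ∀ {C Γ₁ Γ₂ Δ n} → C ≡ FLec → Interpolation C (Γ₁ ++ Γ₂ ++ Γ₂) Δ n →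
                    Interpolation C (Γ₁ ++ Γ₂) Δ n
interpolation-ctr {Γ₁ = Γ₁} {Γ₂} c IH A B p sep =
  interpolant χ sentence (exch (↭-sym A↭) (ctr {Γ₁ = A₁} c left))
    (exch (↭-trans (swap-last B₁ [ χ ] B₂) (++⁺ʳ _ (↭-sym B↭)))
          (ctr {Γ₁ = B₁ ++ [ χ ]} c (exch (swap-last B₁ (B₂ ++ B₂) [ χ ]) right)))
    left-md right-md
  where
  open Refinement (refine Γ₁ {A = A} p)
  doubled : Γ₁ ++ Γ₂ ++ Γ₂ ↭ (A₁ ++ A₂ ++ A₂) ++ (B₁ ++ B₂ ++ B₂)
  doubled = ↭-trans (++⁺ Γ₁↭ (++⁺ Γ₂↭ Γ₂↭))
    (solve 4 (λ a₁ b₁ a₂ b₂ → (a₁ ⊕ b₁) ⊕ ((a₂ ⊕ b₂) ⊕ (a₂ ⊕ b₂)) ⊜ (a₁ ⊕ (a₂ ⊕ a₂)) ⊕ (b₁ ⊕ (b₂ ⊕ b₂)))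
             ↭-refl A₁ B₁ A₂ B₂)
  undouble : ∀ {Γ X Y} → Γ ↭ X ++ Y → (X ++ Y ++ Y) ⊆ᶠᵛ Γ
  undouble {X = X} {Y} q a =
    ↭⇒⊆ᶠᵛ (↭-sym q) (++⁺-⊆ᶠᵛ {X} (λ x → x) (λ y → either (λ y' → y') (λ y' → y') (AnyP.++⁻ Y y)) a)
  open Interpolant (IH (A₁ ++ A₂ ++ A₂) (B₁ ++ B₂ ++ B₂) doubled
    (separated-monoᴬ (undouble {X = A₁} A↭) (separated-monoᴮ (undouble {X = B₁} B↭) sep)))

interpolation-∨L : ∀ {C Γ φ ψ Δ m n} → Interpolation C (Γ ++ [ φ ]) Δ m →
                   Interpolation C (Γ ++ [ ψ ]) Δ n → Interpolation C (Γ ++ [ φ ∨ᶠ ψ ]) Δ (m ⊔ n)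
interpolation-∨L {Γ = Γ} {φ} {ψ} IH₁ IH₂ A B p sep with side Γ p
... | inA A' A↭ Γ↭ =
  interpolant (I₁.χ ∨ᶠ I₂.χ) (sentence-binary I₁.sentence I₂.sentence)
    (exch (↭-sym A↭) (∨L (∨R₁ I₁.left) (∨R₂ I₂.left))) (∨L I₁.right I₂.right)
    (⊔-mono-≤ I₁.left-md I₂.left-md) (⊔-mono-≤ I₁.right-md I₂.right-md)
  where
  Γ↭' : ∀ θ → Γ ++ [ θ ] ↭ (A' ++ [ θ ]) ++ B
  Γ↭' θ = ↭-trans (++⁺ʳ [ θ ] Γ↭) (swap-last A' B [ θ ])
  module I₁ = Interpolant (IH₁ _ B (Γ↭' φ) (separated-monoᴬ (replace-last-⊆ᶠᵛ A↭ ([]⊆ᶠᵛ inj₁)) sep))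
  module I₂ = Interpolant (IH₂ _ B (Γ↭' ψ) (separated-monoᴬ (replace-last-⊆ᶠᵛ A↭ ([]⊆ᶠᵛ inj₂)) sep))
... | inB B' B↭ Γ↭ =
  interpolant (I₁.χ ∧ᶠ I₂.χ) (sentence-binary I₁.sentence I₂.sentence)
    (∧R I₁.left I₂.left)
    (exch (↭-trans (swap-last B' _ _) (++⁺ʳ _ (↭-sym B↭)))
          (∨L (exch (swap-last B' [ φ ] _) (∧L₁ I₁.right))
              (exch (swap-last B' [ ψ ] _) (∧L₂ I₂.right))))
    (⊔-mono-≤ I₁.left-md I₂.left-md) (⊔-mono-≤ I₁.right-md I₂.right-md)
  where
  Γ↭' : ∀ θ → Γ ++ [ θ ] ↭ A ++ (B' ++ [ θ ])
  Γ↭' θ = ↭-trans (++⁺ʳ [ θ ] Γ↭) (++-assoc-↭ A B' [ θ ])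
  module I₁ = Interpolant (IH₁ A _ (Γ↭' φ) (separated-monoᴮ (replace-last-⊆ᶠᵛ B↭ ([]⊆ᶠᵛ inj₁)) sep))
  module I₂ = Interpolant (IH₂ A _ (Γ↭' ψ) (separated-monoᴮ (replace-last-⊆ᶠᵛ B↭ ([]⊆ᶠᵛ inj₂)) sep))

interpolation-∀R : ∀ {C Γ ψ n} y → ¬ FreeInSeq y Γ (just (∀ᶠ ψ)) →
                   Interpolation C Γ (just (sub y ψ)) n → Interpolation C Γ (just (∀ᶠ ψ)) (suc n)
interpolation-∀R {ψ = ψ} y y∉ IH A B p sep =
  interpolant χ sentence left (∀R y y∉right right) (m≤n⇒m≤1+n left-md) (s≤s right-md)
  where
  y∉A : ¬ FV A y
  y∉A a = y∉ (inj₁ (↭-++⇒⊆ᶠᵛˡ p a))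
  open Interpolant (IH A B p (separated-instance {ψ = ψ} y∉A sep))
  y∉right : ¬ FreeInSeq y (B ++ [ χ ]) (just (∀ᶠ ψ))
  y∉right (inj₁ b) = ∷ʳ-sentence-¬FV sentence (λ b' → y∉ (inj₁ (↭-++⇒⊆ᶠᵛʳ p b'))) b

interpolation-∃R : ∀ {C Γ ψ n} t → OccursInSeq t Γ (just (∃ᶠ ψ)) →
                   Interpolation C Γ (just (sub t ψ)) n → Interpolation C Γ (just (∃ᶠ ψ)) (suc n)
interpolation-∃R {ψ = ψ} t occ IH A B p sep with any? (FreeIn? t) A
... | yes t∈A =
  interpolant (χ →ᶠ ∃ᶠ ψ) (sentence-binary {χ₂ = ∃ᶠ ψ} sentence (sentence-∃ {ψ}))
    (→R (∃R t (inj₁ (AnyP.++⁺ˡ (any-free⇒occurs t∈A))) right)) (→L {Γ₂ = []} left ax)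
    (s≤s right-md) (m≤n⇒m≤1+n (⊔-lub left-md z≤n))
  where
  A-side : ∀ {u} → FreeInSeq u A (just (sub t ψ)) → FV A u
  A-side (inj₁ a) = a
  A-side (inj₂ f) with free-sub ψ f
  ... | refl = t∈A
  open Interpolant (IH B A (↭-trans p (++-comm A B)) (separated-swap A-side (λ b → b) sep))
... | no t∉A =
  interpolant χ sentence left (∃R t occ' right) (m≤n⇒m≤1+n left-md) (s≤s right-md)
  where
  open Interpolant (IH A B p (separated-instance {ψ = ψ} t∉A sep))
  occ' : OccursInSeq t (B ++ [ χ ]) (just (∃ᶠ ψ))
  occ' with occurs-partition {Δ = just (∃ᶠ ψ)} occ p
  ... | inj₁ refl                = inj₂ refl
  ... | inj₂ (inj₁ a)            = ⊥-elim (t∉A a)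
  ... | inj₂ (inj₂ (inj₁ b))     = inj₁ (AnyP.++⁺ˡ (any-free⇒occurs b))
  ... | inj₂ (inj₂ (inj₂ ()))

module _ {C Γ₁ Γ₂ φ ψ Δ m n} (IH₁ : Interpolation C Γ₁ (just φ) m)
         (IH₂ : Interpolation C (Γ₂ ++ [ ψ ]) Δ n) where

  -- The minor premise Γ₁ ⇒ φ is interpolated with the roles of the two sides exchanged.
  interpolation-→Lᴬ : ∀ {A A' B} → A ↭ A' ++ [ φ →ᶠ ψ ] → Γ₁ ++ Γ₂ ↭ A' ++ B →
                      Separated A B Δ → Interpolant C A B Δ (m ⊔ n)
  interpolation-→Lᴬ {A} {A'} {B} A↭ Γ↭ sep =
    interpolant (I₁.χ →ᶠ I₂.χ) (sentence-binary I₁.sentence I₂.sentence)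
      (→R (exch (↭-trans (solve 4 (λ a₁ c a₂ f → (a₁ ⊕ c) ⊕ (a₂ ⊕ f) ⊜ ((a₁ ⊕ a₂) ⊕ f) ⊕ c) ↭-refl
                                  A₁ [ I₁.χ ] A₂ [ φ →ᶠ ψ ])
                         (++⁺ʳ [ I₁.χ ] (↭-sym (↭-trans A↭ (++⁺ʳ _ A↭₁₂)))))
                (→L {Γ₁ = A₁ ++ [ I₁.χ ]} I₁.right I₂.left)))
      (exch (↭-trans (↭-sym (++-assoc-↭ B₁ B₂ _)) (++⁺ʳ _ (↭-sym B↭₁₂))) (→L I₁.left I₂.right))
      (⊔-mono-≤ I₁.right-md I₂.left-md) (⊔-mono-≤ I₁.left-md I₂.right-md)
    where
    open Refinement (refine Γ₁ {A = A'} Γ↭) renaming (A↭ to A↭₁₂; B↭ to B↭₁₂)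
    A'⊆A : A' ⊆ᶠᵛ A
    A'⊆A = ↭-++⇒⊆ᶠᵛˡ A↭
    principal : ∀ {u} → FreeIn u (φ →ᶠ ψ) → FV A u
    principal f = ↭-++⇒⊆ᶠᵛʳ {A = A'} A↭ (here f)
    A-side : ∀ {u} → FreeInSeq u A₁ (just φ) → FV A u
    A-side = either (λ a → A'⊆A (↭-++⇒⊆ᶠᵛˡ A↭₁₂ a)) (λ f → principal (inj₁ f))
    A₂ψ⊆A : (A₂ ++ [ ψ ]) ⊆ᶠᵛ A
    A₂ψ⊆A a = either (λ a₂ → A'⊆A (↭-++⇒⊆ᶠᵛʳ {A = A₁} A↭₁₂ a₂)) (λ { (here f) → principal (inj₂ f) })
                     (AnyP.++⁻ A₂ a)
    module I₁ = Interpolant (IH₁ B₁ A₁ (↭-trans Γ₁↭ (++-comm A₁ B₁))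
                                 (separated-swap A-side (↭-++⇒⊆ᶠᵛˡ B↭₁₂) sep))
    module I₂ = Interpolant (IH₂ (A₂ ++ [ ψ ]) B₂ (↭-trans (++⁺ʳ [ ψ ] Γ₂↭) (swap-last A₂ B₂ [ ψ ]))
                                 (separated-monoᴬ A₂ψ⊆A (separated-monoᴮ (↭-++⇒⊆ᶠᵛʳ {A = B₁} B↭₁₂) sep)))

  interpolation-→Lᴮ : ∀ {A B B'} → B ↭ B' ++ [ φ →ᶠ ψ ] → Γ₁ ++ Γ₂ ↭ A ++ B' →
                      Separated A B Δ → Interpolant C A B Δ (m ⊔ n)
  interpolation-→Lᴮ {A} {B} {B'} B↭ Γ↭ sep =
    interpolant (I₁.χ ·ᶠ I₂.χ) (sentence-binary I₁.sentence I₂.sentence)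
      (exch (↭-sym A↭₁₂) (·R I₁.left I₂.left))
      (·L (exch (↭-trans (solve 5 (λ b₁ c₁ b₂ c₂ f →
                                     (b₁ ⊕ c₁) ⊕ ((b₂ ⊕ c₂) ⊕ f) ⊜ ((b₁ ⊕ b₂) ⊕ f) ⊕ (c₁ ⊕ c₂))
                                  ↭-refl B₁ [ I₁.χ ] B₂ [ I₂.χ ] [ φ →ᶠ ψ ])
                         (++⁺ʳ _ (↭-sym (↭-trans B↭ (++⁺ʳ _ B↭₁₂)))))
                (→L {Γ₁ = B₁ ++ [ I₁.χ ]} I₁.right (exch (swap-last B₂ [ ψ ] [ I₂.χ ]) I₂.right))))
      (⊔-mono-≤ I₁.left-md I₂.left-md) (⊔-mono-≤ I₁.right-md I₂.right-md)
    where
    open Refinement (refine Γ₁ {A = A} Γ↭) renaming (A↭ to A↭₁₂; B↭ to B↭₁₂)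
    B'⊆B : B' ⊆ᶠᵛ B
    B'⊆B = ↭-++⇒⊆ᶠᵛˡ B↭
    principal : ∀ {u} → FreeIn u (φ →ᶠ ψ) → FV B u
    principal f = ↭-++⇒⊆ᶠᵛʳ {A = B'} B↭ (here f)
    B₁φ : (B₁ , just φ) ⊆ˢ (B , Δ)
    B₁φ = either (λ b → inj₁ (B'⊆B (↭-++⇒⊆ᶠᵛˡ B↭₁₂ b))) (λ f → inj₁ (principal (inj₁ f)))
    B₂ψ⊆B : (B₂ ++ [ ψ ]) ⊆ᶠᵛ B
    B₂ψ⊆B b = either (λ b₂ → B'⊆B (↭-++⇒⊆ᶠᵛʳ {A = B₁} B↭₁₂ b₂)) (λ { (here f) → principal (inj₂ f) })
                     (AnyP.++⁻ B₂ b)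
    module I₁ = Interpolant (IH₁ A₁ B₁ Γ₁↭ (separated-mono (↭-++⇒⊆ᶠᵛˡ A↭₁₂) B₁φ sep))
    module I₂ = Interpolant (IH₂ A₂ (B₂ ++ [ ψ ]) (↭-trans (++⁺ʳ [ ψ ] Γ₂↭) (++-assoc-↭ A₂ B₂ [ ψ ]))
                                 (separated-monoᴬ (↭-++⇒⊆ᶠᵛʳ {A = A₁} A↭₁₂) (separated-monoᴮ B₂ψ⊆B sep)))

  interpolation-→L : Interpolation C (Γ₁ ++ Γ₂ ++ [ φ →ᶠ ψ ]) Δ (m ⊔ n)
  interpolation-→L A B p sep with side (Γ₁ ++ Γ₂) (↭-trans (↭-reflexive (++-assoc Γ₁ Γ₂ _)) p)
  ... | inA A' A↭ Γ↭ = interpolation-→Lᴬ A↭ Γ↭ sep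
  ... | inB B' B↭ Γ↭ = interpolation-→Lᴮ B↭ Γ↭ sep

interpolation-∃L : ∀ {C Γ φ Δ n} y → ¬ FreeInSeq y (Γ ++ [ ∃ᶠ φ ]) Δ →
                   Interpolation C (Γ ++ [ sub y φ ]) Δ n → Interpolation C (Γ ++ [ ∃ᶠ φ ]) Δ (suc n)
interpolation-∃L {Γ = Γ} {φ} {Δ} y y∉ IH A B p sep with fresh-partition {Δ = Δ} y∉ p | side Γ p
... | y∉A , y∉BΔ | inA A' A↭ Γ↭ =
  interpolant χ sentence (exch (↭-sym A↭) (∃L y y∉left left)) right (s≤s left-md) (m≤n⇒m≤1+n right-md)
  where
  open Interpolant (IH (A' ++ [ sub y φ ]) B (↭-trans (++⁺ʳ _ Γ↭) (swap-last A' B _))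
                       (separated-extendˡ {φ = φ} y∉BΔ (separated-monoᴬ (↭-++⇒⊆ᶠᵛˡ A↭) sep)))
  y∉left : ¬ FreeInSeq y (A' ++ [ ∃ᶠ φ ]) (just χ)
  y∉left = either (λ a → y∉A (↭⇒⊆ᶠᵛ (↭-sym A↭) a)) (sentence y)
... | y∉A , y∉BΔ | inB B' B↭ Γ↭ =
  interpolant χ sentence left
    (exch (↭-trans (swap-last B' [ χ ] _) (++⁺ʳ _ (↭-sym B↭)))
          (∃L y y∉right (exch (swap-last B' _ [ χ ]) right)))
    (m≤n⇒m≤1+n left-md) (s≤s right-md)
  where
  open Interpolant (IH A (B' ++ [ sub y φ ]) (↭-trans (++⁺ʳ _ Γ↭) (++-assoc-↭ A B' _))
                       (separated-extendʳ {φ = φ} y∉A (separated-monoᴮ (↭-++⇒⊆ᶠᵛˡ B↭) sep)))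
  y∉right : ¬ FreeInSeq y ((B' ++ [ χ ]) ++ [ ∃ᶠ φ ]) Δ
  y∉right (inj₂ f) = y∉BΔ (inj₂ f)
  y∉right (inj₁ b) with AnyP.++⁻ (B' ++ [ χ ]) b
  ... | inj₁ b' = ∷ʳ-sentence-¬FV sentence (λ b'' → y∉BΔ (inj₁ (↭-++⇒⊆ᶠᵛˡ B↭ b''))) b'
  ... | inj₂ (here ())

module _ {C Γ φ Δ n} (t : Term) (occ : OccursInSeq t (Γ ++ [ ∀ᶠ φ ]) Δ)
         (IH : Interpolation C (Γ ++ [ sub t φ ]) Δ n) where

  -- If t is free on the B-side, φ(t) is moved to B and the sentence ∀x φ joins the interpolant.
  interpolation-∀Lᴬ : ∀ {A A' B} → A ↭ A' ++ [ ∀ᶠ φ ] → Γ ↭ A' ++ B →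
                      Separated A B Δ → Interpolant C A B Δ (suc n)
  interpolation-∀Lᴬ {A} {A'} {B} A↭ Γ↭ sep with FreeInSeq? t B Δ
  ... | yes t∈BΔ =
    interpolant (∀ᶠ φ ·ᶠ χ) (sentence-binary {χ₁ = ∀ᶠ φ} (sentence-∀ {φ}) sentence)
      (exch (↭-trans (++-comm [ ∀ᶠ φ ] A') (↭-sym A↭)) (·R {Γ₁ = [ ∀ᶠ φ ]} ax left))
      (·L (exch (↭-trans (swap-last B [ χ ] [ ∀ᶠ φ ]) (++-assoc-↭ B [ ∀ᶠ φ ] [ χ ]))
                (∀L t occ' (exch (swap-last B _ [ χ ]) right))))
      (m≤n⇒m≤1+n left-md) (s≤s right-md)
    where
    A'⊆A : A' ⊆ᶠᵛ A
    A'⊆A = ↭-++⇒⊆ᶠᵛˡ A↭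
    open Interpolant (IH A' (B ++ [ sub t φ ]) (↭-trans (++⁺ʳ _ Γ↭) (++-assoc-↭ A' B _))
                         (separated-extendʳ {φ = φ} (λ a → Separated.apart sep t (A'⊆A a) t∈BΔ)
                                            (separated-monoᴬ A'⊆A sep)))
    occ' : OccursInSeq t ((B ++ [ χ ]) ++ [ ∀ᶠ φ ]) Δ
    occ' = Sum.map (λ b → AnyP.++⁺ˡ (AnyP.++⁺ˡ b)) (λ r → r) (freeInSeq⇒occursInSeq Δ t∈BΔ)
  ... | no t∉BΔ =
    interpolant χ sentence (exch (↭-sym A↭) (∀L t occ' left)) right (s≤s left-md) (m≤n⇒m≤1+n right-md)
    where
    open Interpolant (IH (A' ++ [ sub t φ ]) B (↭-trans (++⁺ʳ _ Γ↭) (swap-last A' B _))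
                         (separated-extendˡ {φ = φ} t∉BΔ (separated-monoᴬ (↭-++⇒⊆ᶠᵛˡ A↭) sep)))
    occ' : OccursInSeq t (A' ++ [ ∀ᶠ φ ]) (just χ)
    occ' with occurs-partition {Δ = Δ} occ
                (↭-trans (++⁺ʳ _ Γ↭) (↭-trans (swap-last A' B _) (++⁺ʳ B (↭-sym A↭))))
    ... | inj₁ refl       = inj₁ (AnyP.++⁺ʳ A' (here refl))
    ... | inj₂ (inj₁ a)   = inj₁ (any-free⇒occurs (↭⇒⊆ᶠᵛ A↭ a))
    ... | inj₂ (inj₂ bΔ) = ⊥-elim (t∉BΔ bΔ)

  -- If t is free on the A-side, φ(t) is moved to A and the sentence ∀x φ guards the interpolant.
  interpolation-∀Lᴮ : ∀ {A B B'} → B ↭ B' ++ [ ∀ᶠ φ ] → Γ ↭ A ++ B' →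
                      Separated A B Δ → Interpolant C A B Δ (suc n)
  interpolation-∀Lᴮ {A} {B} {B'} B↭ Γ↭ sep with any? (FreeIn? t) A
  ... | yes t∈A =
    interpolant (∀ᶠ φ →ᶠ χ) (sentence-binary {χ₁ = ∀ᶠ φ} (sentence-∀ {φ}) sentence)
      (→R (∀L t (inj₁ (AnyP.++⁺ˡ (any-free⇒occurs t∈A))) left))
      (exch (↭-trans (shifts [ ∀ᶠ φ ] B')
                     (↭-trans (↭-sym (++-assoc-↭ B' [ ∀ᶠ φ ] _)) (++⁺ʳ _ (↭-sym B↭))))
            (→L {Γ₁ = [ ∀ᶠ φ ]} ax right))
      (s≤s left-md) (m≤n⇒m≤1+n right-md)
    where
    A|B' : Separated A B' Δ
    A|B' = separated-monoᴮ (↭-++⇒⊆ᶠᵛˡ B↭) sep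
    open Interpolant (IH (A ++ [ sub t φ ]) B' (↭-trans (++⁺ʳ _ Γ↭) (swap-last A B' _))
                         (separated-extendˡ {φ = φ} (Separated.apart A|B' t t∈A) A|B'))
  ... | no t∉A =
    interpolant χ sentence left
      (exch (↭-trans (swap-last B' [ χ ] _) (++⁺ʳ _ (↭-sym B↭)))
            (∀L t occ' (exch (swap-last B' _ [ χ ]) right)))
      (m≤n⇒m≤1+n left-md) (s≤s right-md)
    where
    open Interpolant (IH A (B' ++ [ sub t φ ]) (↭-trans (++⁺ʳ _ Γ↭) (++-assoc-↭ A B' _))
                         (separated-extendʳ {φ = φ} t∉A (separated-monoᴮ (↭-++⇒⊆ᶠᵛˡ B↭) sep)))
    occ' : OccursInSeq t ((B' ++ [ χ ]) ++ [ ∀ᶠ φ ]) Δ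
    occ' with occurs-partition {Δ = Δ} occ
                (↭-trans (++⁺ʳ _ Γ↭) (↭-trans (++-assoc-↭ A B' _) (++⁺ˡ A (↭-sym B↭))))
    ... | inj₁ refl             = inj₁ (AnyP.++⁺ʳ (B' ++ [ χ ]) (here refl))
    ... | inj₂ (inj₁ a)         = ⊥-elim (t∉A a)
    ... | inj₂ (inj₂ (inj₁ b))  = inj₁ (any-free⇒occurs (++⁺-⊆ᶠᵛ {B'} ⊆ᶠᵛ-++ˡ (λ f → f) (↭⇒⊆ᶠᵛ B↭ b)))
    ... | inj₂ (inj₂ (inj₂ f))  = inj₂ (onRight-free⇒occurs Δ f)

  interpolation-∀L : Interpolation C (Γ ++ [ ∀ᶠ φ ]) Δ (suc n)
  interpolation-∀L A B p sep with side Γ p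
  ... | inA A' A↭ Γ↭ = interpolation-∀Lᴬ A↭ Γ↭ sep
  ... | inB B' B↭ Γ↭ = interpolation-∀Lᴮ B↭ Γ↭ sep

interpolate : ∀ {C Θ Δ} (d : Der C Θ Δ) → Interpolation C Θ Δ (md d)
interpolate ax               = interpolation-ax
interpolate fL               = interpolation-fL
interpolate eR               = interpolation-eR
interpolate (exch q d)       = interpolation-↭ q (interpolate d)
interpolate (eL {Γ} d)       =
  interpolation-left [] (λ e → eL (exch (↭-reflexive (++-identityʳ _)) e)) (λ _ → refl) (λ ())
    (interpolation-↭ (↭-reflexive (sym (++-identityʳ Γ))) (interpolate d))
interpolate (fR d)           = interpolation-right fR (λ _ → refl) (λ ()) (interpolate d)
interpolate (→L d e)         = interpolation-→L (interpolate d) (interpolate e)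
interpolate (→R d)           = interpolation-→R (interpolate d)
interpolate (·L {φ = φ} {ψ} d) =
  interpolation-left (φ ∷ ψ ∷ []) ·L (λ _ → refl)
    (λ { (here f) → here (inj₁ f) ; (there (here f)) → here (inj₂ f) }) (interpolate d)
interpolate (·R d e)         = interpolation-·R (interpolate d) (interpolate e)
interpolate (∧L₁ d)          = interpolation-left _ ∧L₁ (λ _ → refl) ([]⊆ᶠᵛ inj₁) (interpolate d)
interpolate (∧L₂ d)          = interpolation-left _ ∧L₂ (λ _ → refl) ([]⊆ᶠᵛ inj₂) (interpolate d)
interpolate (∧R d e)         = interpolation-∧R (interpolate d) (interpolate e)
interpolate (∨L d e)         = interpolation-∨L (interpolate d) (interpolate e)
interpolate (∨R₁ d)          = interpolation-right ∨R₁ (λ _ → refl) inj₁ (interpolate d)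
interpolate (∨R₂ d)          = interpolation-right ∨R₂ (λ _ → refl) inj₂ (interpolate d)
interpolate (∀L t occ d)     = interpolation-∀L t occ (interpolate d)
interpolate (∀R y y∉ d)      = interpolation-∀R y y∉ (interpolate d)
interpolate (∃L y y∉ d)      = interpolation-∃L y y∉ (interpolate d)
interpolate (∃R t occ d)     = interpolation-∃R t occ (interpolate d)
interpolate (wkL w d)        = interpolation-wkL w (interpolate d)
interpolate (wkR w d)        = interpolation-wkR w (interpolate d)
interpolate (ctr {Γ₁} c d)   = interpolation-ctr {Γ₁ = Γ₁} c (interpolate d)

theorem6p2 : (C : Calc) (Γ Π : List Formula) (Δ : Maybe Formula)
    (ys zs : List Term) → DisjointVars ys zs →
    FVsIn Γ ys → FVsIn Π zs → FVsInR Δ zs →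
    (d : Der C (Γ ++ Π) Δ) →
    Σ Formula (λ χ → Sentence χ ×
      Σ (Der C Γ (just χ)) (λ d₁ → Σ (Der C (Π ++ [ χ ]) Δ) (λ d₂ →
        md d₁ ≤ md d × md d₂ ≤ md d)))
theorem6p2 C Γ Π Δ ys zs ys#zs Γ⊆ys Π⊆zs Δ⊆zs d =
  χ , sentence , left , right , left-md , right-md
  where
  Γ|Π : Separated Γ Π Δ
  Γ|Π = separated λ t a b → ys#zs t (Γ⊆ys t a) (either (Π⊆zs t) (Δ⊆zs t) b)
  open Interpolant (interpolate d Γ Π ↭-refl Γ|Π)
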